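{- Let $a=31207386885274502188173522132023665167365193670823768234185354856354918873864275$ and $M=36812852443922071184402498913076070503146229820861211558347078871354783744850778$. Then for every integer $x\equiv a \pmod M$ and every $n\in\{0,1,2,\ldots\}$, the number $x^2-F_{3n}/2$ has at least two distinct prime divisors.
   Context: $\{F_n\}_{n\geq 0}$ is the Fibonacci sequence: $F_0=0$, $F_1=1$, and $F_{n+1}=F_n+F_{n-1}$ for $n\geq 1$. (Note $F_{3n}$ is always even, so $F_{3n}/2$ is an integer.) -}

module Defs where

open import Data.Nat using (ℕ; zero; suc; _+_; _/_)

fib : ℕ → ℕ
fib zero = 0
fib (suc zero) = 1
fib (suc (suc n)) = fib (suc n) + fib n

-- F_{3n} / 2 (F_{3n} is always even, so this is exact division)
halfFib3 : ℕ → ℕ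
halfFib3 n = fib (3 Data.Nat.* n) / 2

{-# OPTIONS --safe #-}
module Submission where

-- Write Z = x² − F₃ₙ/2.  The Fibonacci numbers modulo 2M are periodic with period 1890, so
-- F₃ₙ/2 mod M = (F₃ₙ mod 2M)/2 depends only on r = n mod 630, and for x ≡ a (mod M) we get
-- Z ≡ D_r := a² − (F₃ᵣ mod 2M)/2 (mod M).  For each of the 630 residues r a search over the 25
-- prime factors of M finds a prime p ∣ D_r (so p ∣ Z) and divisors q⁺, q⁻ of M such that no power
-- of p is congruent to D_r modulo q⁺, nor to −D_r modulo q⁻; this is checked over one period of
-- p modulo q.  Hence Z ≠ ±pᵏ, so ∣Z∣ has a prime factor other than p.

open import Defs
open import Data.Nat using (ℕ)
open import Data.Nat.Primality using (Prime)
open import Data.Nat.Divisibility using (_∣_)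
open import Data.Integer using (ℤ; +_; _-_; _*_; ∣_∣)
open import Data.Integer.Divisibility using () renaming (_∣_ to _∣ℤ_)
open import Data.Product using (Σ; _×_)
open import Relation.Binary.PropositionalEquality using (_≢_)

open import Data.Bool using (Bool; T)
open import Data.Bool.ListAction using (all)
open import Data.Bool.Properties using (T-∧)
open import Data.Empty using (⊥-elim)
open import Data.Integer as ℤ using (-_; -[1+_])
import Data.Integer.Properties as ℤ
open import Data.Integer.Divisibility.Signed
  using (divides; ∣ᵤ⇒∣; ∣⇒∣ᵤ; ∣-trans; ∣m∣n⇒∣m+n; ∣m∣n⇒∣m-n; ∣m⇒∣-m; ∣m⇒∣m*n)
  renaming (_∣_ to _∣ₛ_; _∣?_ to _∣ₛ?_)
open import Data.Integer.Tactic.RingSolver using (solve-∀)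
open import Data.List as List using (List; []; _∷_; length; foldr)
open import Data.List.Membership.Propositional using (_∈_; mapWith∈; find)
open import Data.List.Relation.Unary.All as All using (All; []; _∷_)
open import Data.List.Relation.Unary.All.Properties using (¬All⇒Any¬)
open import Data.Maybe as Maybe using (Maybe; just; nothing; is-just; from-just; to-witness-T; _<∣>_)
open import Data.Nat as ℕ using (zero; suc; 2+; NonZero; NonTrivial; _+_; _/_; _%_; _^_; _<_; s<s)
import Data.Nat.Properties as ℕ
open import Data.Nat.DivMod
  using (m≡m%n+[m/n]*n; m%n%n≡m%n; %-distribˡ-+; %-distribˡ-*; m%n<n; m%[n*o]/o≡m/o%n; m%n*o≡m*o%[n*o])
open import Data.Nat.Divisibility using (_∣?_; _∣0)
open import Data.Nat.GeneralisedArithmetic using (iterate)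
open import Data.Nat.ListAction using (product)
open import Data.Nat.ListAction.Properties using (∈⇒∣product)
open import Data.Nat.Primality
  using (prime?; prime[2]; prime⇒nonZero; _Rough_; 2-rough; ∤⇒rough-suc; rough∧square>⇒prime)
open import Data.Nat.Primality.Factorisation using (PrimeFactorisation; factorise)
open import Data.Product using (_,_; proj₁; proj₂)
open import Data.Sum using (inj₁; inj₂)
open import Data.Unit using (tt)
open import Function.Base using (_∘_)
open import Function.Bundles using (Equivalence)
open import Relation.Binary.PropositionalEquality
  using (_≡_; refl; sym; trans; cong; cong₂; subst; module ≡-Reasoning)
open import Relation.Nullary using (¬_; yes; no)
open import Relation.Nullary.Decidable using (from-yes)

open ≡-Reasoning

m%n≡o%n⇒n∣m-o : ∀ m o n .{{_ : NonZero n}} → m % n ≡ o % n → + n ∣ₛ + m - + o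
m%n≡o%n⇒n∣m-o m o n eq = divides (+ (m / n) - + (o / n)) (begin
  + m - + o
    ≡⟨ cong₂ (λ u w → + u - + w) (m≡m%n+[m/n]*n m n) (m≡m%n+[m/n]*n o n) ⟩
  + (m % n + m / n ℕ.* n) - + (o % n + o / n ℕ.* n)
    ≡⟨ cong₂ _-_ (lift (m % n) (m / n)) (lift (o % n) (o / n)) ⟩
  (+ (m % n) ℤ.+ + (m / n) * + n) - (+ (o % n) ℤ.+ + (o / n) * + n)
    ≡⟨ cong (λ r → (+ (m % n) ℤ.+ + (m / n) * + n) - (+ r ℤ.+ + (o / n) * + n)) (sym eq) ⟩
  (+ (m % n) ℤ.+ + (m / n) * + n) - (+ (m % n) ℤ.+ + (o / n) * + n)
    ≡⟨ cancel (+ (m % n)) (+ (m / n)) (+ (o / n)) (+ n) ⟩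
  (+ (m / n) - + (o / n)) * + n ∎)
  where
  lift : ∀ r s → + (r + s ℕ.* n) ≡ + r ℤ.+ + s * + n
  lift r s = trans (ℤ.pos-+ r (s ℕ.* n)) (cong (λ x → + r ℤ.+ x) (ℤ.pos-* s n))
  cancel : ∀ r s t u → (r ℤ.+ s * u) - (r ℤ.+ t * u) ≡ (s - t) * u
  cancel = solve-∀

n∣m-m%n : ∀ m n .{{_ : NonZero n}} → + n ∣ₛ + m - + (m % n)
n∣m-m%n m n = m%n≡o%n⇒n∣m-o m (m % n) n (sym (m%n%n≡m%n m n))

square-sub-cong : ∀ {x y : ℤ} m .{{_ : NonZero m}} h → + m ∣ₛ x - y →
                  + m ∣ₛ (x * x - + h) - (y * y - + (h % m))
square-sub-cong {x} {y} m h m∣x-y =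
  subst (+ m ∣ₛ_) (regroup x y (+ h) (+ (h % m)))
    (∣m∣n⇒∣m-n (∣m⇒∣m*n (x ℤ.+ y) m∣x-y) (n∣m-m%n h m))
  where
  regroup : ∀ x y u v → (x - y) * (x ℤ.+ y) - (u - v) ≡ (x * x - u) - (y * y - v)
  regroup = solve-∀

^%-shift : ∀ p o q .{{_ : NonZero q}} → p ^ o % q ≡ 1 → ∀ j → p ^ (o + j) % q ≡ p ^ j % q
^%-shift p o q p^o≡1 j = begin
  p ^ (o + j) % q                 ≡⟨ cong (_% q) (ℕ.^-distribˡ-+-* p o j) ⟩
  p ^ o ℕ.* p ^ j % q             ≡⟨ %-distribˡ-* (p ^ o) (p ^ j) q ⟩
  p ^ o % q ℕ.* (p ^ j % q) % q   ≡⟨ cong (λ u → u ℕ.* (p ^ j % q) % q) p^o≡1 ⟩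
  1 ℕ.* (p ^ j % q) % q           ≡⟨ cong (_% q) (ℕ.*-identityˡ (p ^ j % q)) ⟩
  p ^ j % q % q                   ≡⟨ m%n%n≡m%n (p ^ j) q ⟩
  p ^ j % q                       ∎

^%-periodic : ∀ p o q .{{_ : NonZero q}} → p ^ o % q ≡ 1 → ∀ t j → p ^ (t ℕ.* o + j) % q ≡ p ^ j % q
^%-periodic p o q p^o≡1 zero    j = refl
^%-periodic p o q p^o≡1 (suc t) j = begin
  p ^ (o + t ℕ.* o + j) % q   ≡⟨ cong (λ i → p ^ i % q) (ℕ.+-assoc o (t ℕ.* o) j) ⟩
  p ^ (o + (t ℕ.* o + j)) % q ≡⟨ ^%-shift p o q p^o≡1 (t ℕ.* o + j) ⟩
  p ^ (t ℕ.* o + j) % q       ≡⟨ ^%-periodic p o q p^o≡1 t j ⟩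
  p ^ j % q                   ∎

^%-reduce : ∀ p o q .{{_ : NonZero q}} .{{_ : NonZero o}} → p ^ o % q ≡ 1 →
            ∀ k → p ^ k % q ≡ p ^ (k % o) % q
^%-reduce p o q p^o≡1 k = begin
  p ^ k % q                         ≡⟨ cong (λ i → p ^ i % q) (m≡m%n+[m/n]*n k o) ⟩
  p ^ (k % o + k / o ℕ.* o) % q     ≡⟨ cong (λ i → p ^ i % q) (ℕ.+-comm (k % o) (k / o ℕ.* o)) ⟩
  p ^ (k / o ℕ.* o + k % o) % q     ≡⟨ ^%-periodic p o q p^o≡1 (k / o) (k % o) ⟩
  p ^ (k % o) % q                   ∎

PowersAvoid : ℕ → ℕ → ℤ → Set
PowersAvoid q p D = ∀ k → ¬ (+ q ∣ₛ + (p ^ k) - D)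

module _ (q p : ℕ) .{{_ : NonZero q}} (D : ℤ) where

  private
    Hits : ℕ → Set
    Hits v = + q ∣ₛ + v - D

  hits-resp-% : ∀ {u w} → u % q ≡ w % q → Hits u → Hits w
  hits-resp-% {u} {w} eq q∣u-D =
    subst (+ q ∣ₛ_) (shuffle (+ u) (+ w) D) (∣m∣n⇒∣m-n q∣u-D (m%n≡o%n⇒n∣m-o u w q eq))
    where
    shuffle : ∀ u w d → (u - d) - (u - w) ≡ w - d
    shuffle = solve-∀

  avoids-by-period : ∀ o .{{_ : NonZero o}} → p ^ o % q ≡ 1 →
                     (∀ j → j < o → ¬ Hits (p ^ j % q)) → PowersAvoid q p D
  avoids-by-period o p^o≡1 misses k hit =
    misses (k % o) (m%n<n k o)
      (hits-resp-% (trans (^%-reduce p o q p^o≡1 k) (sym (m%n%n≡m%n (p ^ (k % o)) q))) hit)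

  private
    next-power : ∀ {i v} → v ≡ p ^ i % q → v ℕ.* p % q ≡ p ^ suc i % q
    next-power {i} refl = begin
      p ^ i % q ℕ.* p % q            ≡⟨ %-distribˡ-* (p ^ i % q) p q ⟩
      p ^ i % q % q ℕ.* (p % q) % q  ≡⟨ cong (λ u → u ℕ.* (p % q) % q) (m%n%n≡m%n (p ^ i) q) ⟩
      p ^ i % q ℕ.* (p % q) % q      ≡⟨ %-distribˡ-* (p ^ i) p q ⟨
      p ^ i ℕ.* p % q                ≡⟨ cong (_% q) (ℕ.*-comm (p ^ i) p) ⟩
      p ^ suc i % q                  ∎

    extend-misses : ∀ {i v} → v ≡ p ^ i % q → ¬ Hits v → (∀ j → j < i → ¬ Hits (p ^ j % q)) →
                    ∀ j → j < suc i → ¬ Hits (p ^ j % q)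
    extend-misses v≡ v-misses misses j j<1+i with ℕ.m<1+n⇒m<n∨m≡n j<1+i
    ... | inj₁ j<i  = misses j j<i
    ... | inj₂ refl = subst (λ u → ¬ Hits u) v≡ v-misses

    scan : (fuel i v : ℕ) → v ≡ p ^ i % q → (∀ j → j < i → ¬ Hits (p ^ j % q)) → Maybe (PowersAvoid q p D)
    scan zero       i v v≡ misses = nothing
    scan (suc fuel) i v v≡ misses with + q ∣ₛ? (+ v - D)
    ... | yes _ = nothing
    ... | no v-misses with v ℕ.* p % q ℕ.≟ 1
    ...   | yes closes = just (avoids-by-period (suc i) (trans (sym (next-power {i} v≡)) closes)
                                                (extend-misses {i} v≡ v-misses misses))
    ...   | no _       = scan fuel (suc i) (v ℕ.* p % q) (next-power {i} v≡) (extend-misses {i} v≡ v-misses misses)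

  avoids? : ℕ → Maybe (PowersAvoid q p D)
  avoids? fuel = scan fuel 0 (1 % q) refl (λ _ ())

HasTwoPrimeDivisors : ℕ → Set
HasTwoPrimeDivisors n = Σ ℕ λ p → Σ ℕ λ q → Prime p × Prime q × p ≢ q × (p ∣ n) × (q ∣ n)

product-constant : ∀ {p} {xs : List ℕ} → All (_≡ p) xs → product xs ≡ p ^ length xs
product-constant []                = refl
product-constant {p} (refl ∷ xs≡p) = cong (p ℕ.*_) (product-constant xs≡p)

prime-divisor-other-than : ∀ {n} p → (∀ k → n ≢ p ^ k) → Σ ℕ λ q → Prime q × p ≢ q × q ∣ n
prime-divisor-other-than {zero} p _ with p ℕ.≟ 2
... | yes refl = 3 , from-yes (prime? 3) , (λ ()) , (3 ∣0)
... | no p≢2   = 2 , prime[2] , p≢2 , (2 ∣0)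
prime-divisor-other-than {n@(suc _)} p not-power = from-factorisation (factorise n)
  where
  from-factorisation : PrimeFactorisation n → Σ ℕ λ q → Prime q × p ≢ q × q ∣ n
  from-factorisation record { factors = fs ; isFactorisation = n≡∏fs ; factorsPrime = fs-prime }
    with All.all? (ℕ._≟ p) fs
  ... | yes all≡p = ⊥-elim (not-power (length fs) (trans n≡∏fs (product-constant all≡p)))
  ... | no ¬all≡p with find (¬All⇒Any¬ (ℕ._≟ p) fs ¬all≡p)
  ...   | q , q∈fs , q≢p =
    q , All.lookup fs-prime q∈fs , (λ p≡q → q≢p (sym p≡q)) , subst (q ∣_) (sym n≡∏fs) (∈⇒∣product q∈fs)

trial-division : (fuel d n : ℕ) .{{_ : NonTrivial n}} → d Rough n → Maybe (Prime n)
trial-division fuel d n d-rough with n ℕ.<? d ℕ.* d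
... | yes n<d² = just (rough∧square>⇒prime d-rough n<d²)
trial-division zero       d n d-rough | no _ = nothing
trial-division (suc fuel) d n d-rough | no _ with d ∣? n
... | yes _  = nothing
... | no d∤n = trial-division fuel (suc d) n (∤⇒rough-suc d∤n d-rough)

prime-by-trial-division? : (n : ℕ) → Maybe (Prime n)
prime-by-trial-division? n@(2+ _) = trial-division n 2 n 2-rough
prime-by-trial-division? _        = nothing

all-prime? : (ns : List ℕ) → Maybe (All Prime ns)
all-prime? []       = just []
all-prime? (n ∷ ns) = Maybe.zipWith _∷_ (prime-by-trial-division? n) (all-prime? ns)

record PowerObstruction (m p : ℕ) (D : ℤ) : Set where
  constructor obstruction
  field
    {q}    : ℕ
    q∣m    : q ∣ m
    avoids : PowersAvoid q p D

record Certificate (m : ℕ) (D : ℤ) : Set where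
  constructor certificate
  field
    {p}        : ℕ
    p-prime    : Prime p
    p∣m        : p ∣ m
    p∣D        : + p ∣ₛ D
    obstruct⁺  : PowerObstruction m p D
    obstruct⁻  : PowerObstruction m p (- D)

power-excluded : ∀ {m p D Z} → PowerObstruction m p D → + m ∣ₛ Z - D → ∀ k → Z ≢ + (p ^ k)
power-excluded {m} (obstruction {q} q∣m avoids) m∣Z-D k refl = avoids k (∣-trans (∣ᵤ⇒∣ {+ q} {+ m} q∣m) m∣Z-D)

certificate⇒∣Z∣≢p^k : ∀ {m D} (c : Certificate m D) Z → + m ∣ₛ Z - D → ∀ k → ∣ Z ∣ ≢ Certificate.p c ^ k
certificate⇒∣Z∣≢p^k c (+ n) m∣Z-D k n≡p^k =
  power-excluded (Certificate.obstruct⁺ c) m∣Z-D k (cong +_ n≡p^k)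
certificate⇒∣Z∣≢p^k {m} {D} c Z@(-[1+ n ]) m∣Z-D k n≡p^k =
  power-excluded (Certificate.obstruct⁻ c) m∣-Z+D k (cong +_ n≡p^k)
  where
  negate : ∀ z d → - (z - d) ≡ - z - - d
  negate = solve-∀
  m∣-Z+D : + m ∣ₛ - Z - - D
  m∣-Z+D = subst (+ m ∣ₛ_) (negate Z D) (∣m⇒∣-m m∣Z-D)

certificate⇒two-prime-divisors : ∀ {m D Z} → Certificate m D → + m ∣ₛ Z - D → HasTwoPrimeDivisors ∣ Z ∣
certificate⇒two-prime-divisors {m} {D} {Z} c m∣Z-D =
  let q , q-prime , p≢q , q∣Z = prime-divisor-other-than p (certificate⇒∣Z∣≢p^k c Z m∣Z-D)
  in p , q , p-prime , q-prime , p≢q , ∣⇒∣ᵤ p∣Z , q∣Z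
  where
  open Certificate c
  restore : ∀ z d → z - d ℤ.+ d ≡ z
  restore = solve-∀
  p∣Z : + p ∣ₛ Z
  p∣Z = subst (+ p ∣ₛ_) (restore Z D) (∣m∣n⇒∣m+n (∣-trans (∣ᵤ⇒∣ {+ p} {+ m} p∣m) m∣Z-D) p∣D)

iterate-intertwine : ∀ {A : Set} {f : A → A} {g : ℕ → A} → (∀ k → f (g k) ≡ g (suc k)) →
                     ∀ n k → iterate f (g k) n ≡ g (n + k)
iterate-intertwine             fg zero    k = refl
iterate-intertwine {f = f} {g} fg (suc n) k = begin
  iterate f (f (g k)) n   ≡⟨ cong (λ x → iterate f x n) (fg k) ⟩
  iterate f (g (suc k)) n ≡⟨ iterate-intertwine fg n (suc k) ⟩
  g (n + suc k)           ≡⟨ cong g (ℕ.+-suc n k) ⟩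
  g (suc n + k)           ∎

T-all-iterate : ∀ {A : Set} (P : A → Bool) (f : A → A) x n → T (all P (List.iterate f x n)) →
                ∀ i → i < n → T (P (iterate f x i))
T-all-iterate P f x (suc n) t zero    _         = proj₁ (Equivalence.to T-∧ t)
T-all-iterate P f x (suc n) t (suc i) (s<s i<n) =
  T-all-iterate P f (f x) n (proj₂ (Equivalence.to T-∧ t)) i i<n

module _ (m : ℕ) .{{_ : NonZero m}} where

  fibMod : ℕ → ℕ × ℕ
  fibMod k = fib k % m , fib (suc k) % m

  fibStep : ℕ × ℕ → ℕ × ℕ
  fibStep (u , v) = v , (u + v) % m

  iterate-fibStep : ∀ n k → iterate fibStep (fibMod k) n ≡ fibMod (n + k)
  iterate-fibStep = iterate-intertwine λ k → cong (fib (suc k) % m ,_) (begin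
    (fib k % m + fib (suc k) % m) % m ≡⟨ %-distribˡ-+ (fib k) (fib (suc k)) m ⟨
    (fib k + fib (suc k)) % m         ≡⟨ cong (_% m) (ℕ.+-comm (fib k) (fib (suc k))) ⟩
    fib (suc (suc k)) % m             ∎)

  fib%-reduce : ∀ T .{{_ : NonZero T}} → iterate fibStep (fibMod 0) T ≡ fibMod 0 →
                ∀ k → fib k % m ≡ fib (k % T) % m
  fib%-reduce T period k = cong proj₁ (begin
    fibMod k                                       ≡⟨ cong fibMod (m≡m%n+[m/n]*n k T) ⟩
    fibMod (k % T + k / T ℕ.* T)                   ≡⟨ iterate-fibStep (k % T) (k / T ℕ.* T) ⟨
    iterate fibStep (fibMod (k / T ℕ.* T)) (k % T) ≡⟨ cong (λ s → iterate fibStep s (k % T)) (multiple (k / T)) ⟩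
    iterate fibStep (fibMod 0) (k % T)             ≡⟨ iterate-fibStep (k % T) 0 ⟩
    fibMod (k % T + 0)                             ≡⟨ cong fibMod (ℕ.+-identityʳ (k % T)) ⟩
    fibMod (k % T)                                 ∎)
    where
    multiple : ∀ t → fibMod (t ℕ.* T) ≡ fibMod 0
    multiple zero    = refl
    multiple (suc t) = begin
      fibMod (T + t ℕ.* T)                  ≡⟨ iterate-fibStep T (t ℕ.* T) ⟨
      iterate fibStep (fibMod (t ℕ.* T)) T  ≡⟨ cong (λ s → iterate fibStep s T) (multiple t) ⟩
      iterate fibStep (fibMod 0) T          ≡⟨ period ⟩
      fibMod 0                              ∎

a : ℕ
a = 31207386885274502188173522132023665167365193670823768234185354856354918873864275

M : ℕ
M = 36812852443922071184402498913076070503146229820861211558347078871354783744850778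

M-factors : List ℕ
M-factors = 2 ∷ 11 ∷ 19 ∷ 29 ∷ 31 ∷ 71 ∷ 181 ∷ 211 ∷ 271 ∷ 379 ∷ 541 ∷ 631 ∷ 811 ∷ 911 ∷ 1009 ∷ 5779 ∷
            17011 ∷ 21211 ∷ 31249 ∷ 42391 ∷ 69931 ∷ 85429 ∷ 119611 ∷ 767131 ∷ 912871 ∷ []

M≡∏M-factors : M ≡ product M-factors
M≡∏M-factors = refl

M-factors-prime : All Prime M-factors
M-factors-prime = from-just (all-prime? M-factors)

∈M-factors⇒∣M : ∀ {q} → q ∈ M-factors → q ∣ M
∈M-factors⇒∣M {q} q∈ = subst (q ∣_) (sym M≡∏M-factors) (∈⇒∣product q∈)

first-just : ∀ {A : Set} → List (Maybe A) → Maybe A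
first-just = foldr _<∣>_ nothing

obstruction? : (p : ℕ) (D : ℤ) → Maybe (PowerObstruction M p D)
obstruction? p D =
  first-just (mapWith∈ M-factors λ q∈ → Maybe.map (obstruction (∈M-factors⇒∣M q∈)) (try q∈))
  where
  -- 60 is the largest multiplicative order modulo a factor of M that the search needs
  try : ∀ {q} → q ∈ M-factors → Maybe (PowersAvoid q p D)
  try {q} q∈ = avoids? q p {{prime⇒nonZero (All.lookup M-factors-prime q∈)}} D 60

certify : (D : ℤ) → Maybe (Certificate M D)
certify D = first-just (mapWith∈ M-factors candidate)
  where
  candidate : ∀ {p} → p ∈ M-factors → Maybe (Certificate M D)
  candidate {p} p∈ with + p ∣ₛ? D
  ... | no _    = nothing
  ... | yes p∣D = Maybe.zipWith (certificate (All.lookup M-factors-prime p∈) (∈M-factors⇒∣M p∈) p∣D)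
                    (obstruction? p D) (obstruction? p (- D))

residue : ℕ → ℤ
residue R = + a * + a - + (R / 2)

fibStep³ : ℕ × ℕ → ℕ × ℕ
fibStep³ s = iterate (fibStep (M ℕ.* 2)) s 3

certifiable : ℕ × ℕ → Bool
certifiable s = is-just (certify (residue (proj₁ s)))

all-certified : T (all certifiable (List.iterate fibStep³ (fibMod (M ℕ.* 2) 0) 630))
all-certified = tt

certified : ∀ r → r < 630 → Certificate M (residue (fib (3 ℕ.* r) % (M ℕ.* 2)))
certified r r<630 =
  to-witness-T (certify _)
    (subst (T ∘ certifiable) orbit
      (T-all-iterate certifiable fibStep³ (fibMod (M ℕ.* 2) 0) 630 all-certified r r<630))
  where
  step : ∀ k → fibStep³ (fibMod (M ℕ.* 2) (3 ℕ.* k)) ≡ fibMod (M ℕ.* 2) (3 ℕ.* suc k)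
  step k = trans (iterate-fibStep (M ℕ.* 2) 3 (3 ℕ.* k)) (cong (fibMod (M ℕ.* 2)) (sym (ℕ.*-suc 3 k)))
  orbit : iterate fibStep³ (fibMod (M ℕ.* 2) 0) r ≡ fibMod (M ℕ.* 2) (3 ℕ.* r)
  orbit = trans (iterate-intertwine {g = λ k → fibMod (M ℕ.* 2) (3 ℕ.* k)} step r 0)
                (cong (λ k → fibMod (M ℕ.* 2) (3 ℕ.* k)) (ℕ.+-identityʳ r))

fib-period : iterate (fibStep (M ℕ.* 2)) (fibMod (M ℕ.* 2) 0) 1890 ≡ fibMod (M ℕ.* 2) 0
fib-period = refl

halfFib3%M : ∀ n → halfFib3 n % M ≡ fib (3 ℕ.* (n % 630)) % (M ℕ.* 2) / 2
halfFib3%M n = begin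
  fib (3 ℕ.* n) / 2 % M                 ≡⟨ m%[n*o]/o≡m/o%n (fib (3 ℕ.* n)) M 2 ⟨
  fib (3 ℕ.* n) % (M ℕ.* 2) / 2         ≡⟨ cong (_/ 2) (fib%-reduce (M ℕ.* 2) 1890 fib-period (3 ℕ.* n)) ⟩
  fib (3 ℕ.* n % 1890) % (M ℕ.* 2) / 2  ≡⟨ cong (λ k → fib k % (M ℕ.* 2) / 2) 3n%1890 ⟩
  fib (3 ℕ.* (n % 630)) % (M ℕ.* 2) / 2 ∎
  where
  3n%1890 : 3 ℕ.* n % 1890 ≡ 3 ℕ.* (n % 630)
  3n%1890 = begin
    3 ℕ.* n % 1890   ≡⟨ cong (_% 1890) (ℕ.*-comm 3 n) ⟩
    n ℕ.* 3 % 1890   ≡⟨ m%n*o≡m*o%[n*o] n 630 3 ⟨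
    n % 630 ℕ.* 3    ≡⟨ ℕ.*-comm (n % 630) 3 ⟩
    3 ℕ.* (n % 630)  ∎

theorem1p3 : (x : ℤ) → (+ 36812852443922071184402498913076070503146229820861211558347078871354783744850778) ∣ℤ (x - + 31207386885274502188173522132023665167365193670823768234185354856354918873864275) →
    (n : ℕ) →
    Σ ℕ λ p → Σ ℕ λ q → Prime p × Prime q × p ≢ q ×
      (p ∣ ∣ x * x - + halfFib3 n ∣) × (q ∣ ∣ x * x - + halfFib3 n ∣)
theorem1p3 x hx n =
  certificate⇒two-prime-divisors {Z = x * x - + halfFib3 n} (certified r (m%n<n n 630)) congruent
  where
  r = n % 630
  congruent : + M ∣ₛ (x * x - + halfFib3 n) - residue (fib (3 ℕ.* r) % (M ℕ.* 2))
  congruent = subst (λ h → + M ∣ₛ (x * x - + halfFib3 n) - (+ a * + a - + h)) (halfFib3%M n)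
                (square-sub-cong {x} {+ a} M (halfFib3 n) (∣ᵤ⇒∣ {+ M} {x - + a} hx))
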